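{- Let $\Omega=(G,\mathcal{C})$ be a linear biased graph. Suppose $C$ is an unbalanced cycle and $T$ is a spanning tree of $G$ with $E(C)\cap E(T)=\emptyset$. Then there exists $e\in E(C)$ such that the fundamental cycle $C(e,T)$ is unbalanced.
   Context: A theta graph consists of three cycles $C_1,C_2,C_3$ with $C_i\triangle C_j=C_k$ for distinct $i,j,k$. A biased graph $\Omega=(G,\mathcal{C})$ is a graph $G$ with a set $\mathcal{C}$ of cycles (balanced; others unbalanced) such that if two cycles of a theta graph lie in $\mathcal{C}$ so does the third. It is linear if every cycle of $G$ expressible as a symmetric difference of cycles of $\mathcal{C}$ belongs to $\mathcal{C}$. For a spanning tree $T$ and $e\notin E(T)$, $C(e,T)$ denotes the unique cycle in $T\cup\{e\}$. -}

module Defs where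

open import Data.Nat using (ℕ; suc)
open import Data.Fin using (Fin; zero; suc; inject₁; fromℕ)
open import Data.Fin.Subset using (Subset; _∈_; _⊆_; _∪_; ⁅_⁆) renaming (⊥ to ∅)
open import Data.Bool using (Bool; T; _xor_)
open import Data.Vec using (zipWith)
open import Data.Product using (Σ; ∃; ∃-syntax; _×_; _,_)
open import Data.Sum using (_⊎_)
open import Data.Empty using (⊥)
open import Relation.Binary.PropositionalEquality using (_≡_)
open import Function.Definitions using (Injective)
open import Function.Bundles using (_⇔_)

-- A finite graph (loops and parallel edges allowed):
-- vertices Fin n, edges Fin m, each edge has an (unordered) pair of ends.
record Graph : Set where
  field
    n   : ℕ
    m   : ℕ
    ends : Fin m → Fin n × Fin n

module _ (G : Graph) where
  open Graph G

  Joins : Fin m → Fin n → Fin n → Set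
  Joins e u v = (ends e ≡ (u , v)) ⊎ (ends e ≡ (v , u))

  EdgeSet : Set
  EdgeSet = Subset m

  _△_ : EdgeSet → EdgeSet → EdgeSet
  A △ B = zipWith _xor_ A B

  -- S is (the edge set of) a cycle: there are k+1 distinct vertices
  -- v₀ … v_k and k+1 distinct edges e₀ … e_k with e_i joining v_i and
  -- v_{i+1} (indices mod k+1), and S = {e₀,…,e_k}.
  -- (k = 0: a loop; k = 1: a pair of parallel edges.)
  record CycleWitness (S : EdgeSet) (k : ℕ) : Set where
    field
      vs    : Fin (suc k) → Fin n
      es    : Fin (suc k) → Fin m
      vs-inj : Injective _≡_ _≡_ vs
      es-inj : Injective _≡_ _≡_ es
      step  : (i : Fin k) → Joins (es (inject₁ i)) (vs (inject₁ i)) (vs (suc i))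
      close : Joins (es (fromℕ k)) (vs (fromℕ k)) (vs zero)
      edges : (e : Fin m) → (e ∈ S) ⇔ (∃[ i ] es i ≡ e)

  IsCycle : EdgeSet → Set
  IsCycle S = ∃[ k ] CycleWitness S k

  -- A biased graph: a set of balanced cycles (given by its characteristic
  -- function) satisfying the theta property.
  record BiasedGraph : Set where
    field
      balanced       : EdgeSet → Bool
      balanced⇒cycle : ∀ C → T (balanced C) → IsCycle C
      theta          : ∀ C₁ C₂ C₃ → IsCycle C₁ → IsCycle C₂ → IsCycle C₃ →
                       C₁ △ C₂ ≡ C₃ →
                       T (balanced C₁) → T (balanced C₂) → T (balanced C₃)

  data InSpan (bal : EdgeSet → Bool) : EdgeSet → Set where
    span-∅   : InSpan bal ∅
    span-add : ∀ {S C} → InSpan bal S → T (bal C) → InSpan bal (S △ C)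

  IsLinear : BiasedGraph → Set
  IsLinear Ω = ∀ C → IsCycle C → InSpan (BiasedGraph.balanced Ω) C →
               T (BiasedGraph.balanced Ω C)

  data Reach (F : EdgeSet) : Fin n → Fin n → Set where
    reach-refl : ∀ {u} → Reach F u u
    reach-step : ∀ {u w v} (e : Fin m) → e ∈ F → Joins e u w →
                 Reach F w v → Reach F u v

  IsSpanningTree : EdgeSet → Set
  IsSpanningTree F = (∀ u v → Reach F u v) × (∀ D → IsCycle D → D ⊆ F → ⊥)

  -- D is the fundamental cycle C(e,F): a cycle contained in F ∪ {e}
  -- (for e ∉ F and F a spanning tree it exists and is unique)
  IsFundCycle : Fin m → EdgeSet → EdgeSet → Set
  IsFundCycle e F D = IsCycle D × D ⊆ (F ∪ ⁅ e ⁆)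

  Disjoint : EdgeSet → EdgeSet → Set
  Disjoint A B = ∀ e → e ∈ A → e ∈ B → ⊥

module Submission where

-- Fix a spanning tree F and, for every ordered pair of vertices
-- u, w, a simple path P(u,w) in F.  An edge e of C joining u and w has the
-- fundamental cycle D(e) = {e} △ P(u,w); it really is a cycle because e ∉ F.
-- Traverse C as a closed walk c and sum D(e) over its edges: the sum is
-- (edges of c) △ (edge parity of the closed walk in F obtained by replacing
-- every edge of c by its tree path).  In a forest every closed walk has
-- empty edge parity, so the sum is exactly C.  Hence if every D(e) were
-- balanced, C would lie in the span of the balanced cycles and, by linearity,
-- be balanced itself.

open import Defs
open import Data.Nat using (ℕ; zero; suc)
open import Data.Fin using (Fin; zero; suc; inject₁; fromℕ; _≟_)
open import Data.Fin.Subset using (Subset; _∈_; _∉_; _⊆_; _∪_; ⁅_⁆) renaming (⊥ to ∅)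
open import Data.Fin.Subset.Properties using (∉⊥; x∈⁅x⁆; x∈⁅y⁆⇒x≡y; x∈p∪q⁺; ⊆-antisym)
open import Data.Fin.Properties using (fromℕ≢inject₁; inject₁-injective; suc-injective)
open import Data.Bool using (true; false; T; _xor_)
open import Data.Bool.Properties using (xor-assoc; xor-comm; xor-identityˡ; xor-identityʳ; xor-same)
open import Data.Vec using ([]; _∷_; zipWith; lookup)
open import Data.Vec.Properties using (zipWith-assoc; zipWith-comm; zipWith-identityˡ; zipWith-identityʳ; lookup-zipWith; []=⇒lookup; lookup⇒[]=)
open import Data.Product using (Σ; ∃-syntax; _×_; _,_; proj₁; proj₂; swap)
open import Data.Product.Properties using (,-injective)
open import Data.Sum using (_⊎_; inj₁; inj₂; [_,_]′)
open import Data.Unit using (⊤; tt)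
open import Data.Empty using (⊥; ⊥-elim)
open import Function using (id)
open import Function.Definitions using (Injective)
open import Function.Bundles using (mk⇔; Equivalence)
open import Algebra.Bundles using (CommutativeSemigroup)
open import Algebra.Properties.CommutativeSemigroup using (interchange)
open import Relation.Nullary using (¬_; Dec; yes; no; contradiction)
open import Relation.Nullary.Decidable using (T?)
open import Relation.Binary.PropositionalEquality using (_≡_; refl; sym; trans; cong; cong₂; subst; module ≡-Reasoning)
open import Relation.Binary.PropositionalEquality.Algebra using (isMagma)

module SymmetricDifference {k : ℕ} where

  infixl 6 _⊕_
  _⊕_ : Subset k → Subset k → Subset k
  _⊕_ = zipWith _xor_

  ⊕-assoc : ∀ A B C → (A ⊕ B) ⊕ C ≡ A ⊕ (B ⊕ C)
  ⊕-assoc = zipWith-assoc xor-assoc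

  ⊕-comm : ∀ A B → A ⊕ B ≡ B ⊕ A
  ⊕-comm = zipWith-comm xor-comm

  ⊕-identityˡ : ∀ A → ∅ ⊕ A ≡ A
  ⊕-identityˡ = zipWith-identityˡ xor-identityˡ

  ⊕-identityʳ : ∀ A → A ⊕ ∅ ≡ A
  ⊕-identityʳ = zipWith-identityʳ xor-identityʳ

  ⊕-self : ∀ A → A ⊕ A ≡ ∅
  ⊕-self = xor-cancel
    where
    xor-cancel : ∀ {j} (A : Subset j) → zipWith _xor_ A A ≡ ∅
    xor-cancel []      = refl
    xor-cancel (a ∷ A) = cong₂ _∷_ (xor-same a) (xor-cancel A)

  ⊕-commutativeSemigroup : CommutativeSemigroup _ _
  ⊕-commutativeSemigroup = record
    { Carrier                = Subset k
    ; _≈_                    = _≡_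
    ; _∙_                    = _⊕_
    ; isCommutativeSemigroup = record
      { isSemigroup = record { isMagma = isMagma _⊕_ ; assoc = ⊕-assoc }
      ; comm        = ⊕-comm
      }
    }

  ⊕-interchange : ∀ A B C D → (A ⊕ B) ⊕ (C ⊕ D) ≡ (A ⊕ C) ⊕ (B ⊕ D)
  ⊕-interchange = interchange ⊕-commutativeSemigroup

  private
    ∉⇒lookup : ∀ {x} {A : Subset k} → x ∉ A → lookup A x ≡ false
    ∉⇒lookup {x} {A} x∉A with lookup A x in eq
    ... | true  = contradiction (lookup⇒[]= x A eq) x∉A
    ... | false = refl

    lookup-⊕ : ∀ x A B → lookup (A ⊕ B) x ≡ lookup A x xor lookup B x
    lookup-⊕ x A B = lookup-zipWith _xor_ x A B

    xor-true : ∀ a b → a xor b ≡ true → a ≡ true ⊎ b ≡ true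
    xor-true true  _ _  = inj₁ refl
    xor-true false _ eq = inj₂ eq

  ∈⊕⁻ : ∀ {x} A B → x ∈ A ⊕ B → x ∈ A ⊎ x ∈ B
  ∈⊕⁻ {x} A B x∈ with xor-true (lookup A x) (lookup B x) (trans (sym (lookup-⊕ x A B)) ([]=⇒lookup x∈))
  ... | inj₁ eq = inj₁ (lookup⇒[]= x A eq)
  ... | inj₂ eq = inj₂ (lookup⇒[]= x B eq)

  ∈⊕⁺ˡ : ∀ {x} {A B : Subset k} → x ∈ A → x ∉ B → x ∈ A ⊕ B
  ∈⊕⁺ˡ {x} {A} {B} x∈A x∉B =
    lookup⇒[]= x (A ⊕ B) (trans (lookup-⊕ x A B) (cong₂ _xor_ ([]=⇒lookup x∈A) (∉⇒lookup x∉B)))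

  ∈⊕⁺ʳ : ∀ {x} {A B : Subset k} → x ∉ A → x ∈ B → x ∈ A ⊕ B
  ∈⊕⁺ʳ {x} {A} {B} x∉A x∈B =
    lookup⇒[]= x (A ⊕ B) (trans (lookup-⊕ x A B) (cong₂ _xor_ (∉⇒lookup x∉A) ([]=⇒lookup x∈B)))

open SymmetricDifference

module Walks (G : Graph) where
  open Graph G

  same-ends : ∀ {e u w a b} → Joins G e u w → Joins G e a b →
              (a ≡ u × b ≡ w) ⊎ (a ≡ w × b ≡ u)
  same-ends (inj₁ p) (inj₁ q) = inj₁ (,-injective (trans (sym q) p))
  same-ends (inj₁ p) (inj₂ q) = inj₂ (swap (,-injective (trans (sym q) p)))
  same-ends (inj₂ p) (inj₁ q) = inj₂ (,-injective (trans (sym q) p))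
  same-ends (inj₂ p) (inj₂ q) = inj₁ (swap (,-injective (trans (sym q) p)))

  joins-sym : ∀ {e u w} → Joins G e u w → Joins G e w u
  joins-sym (inj₁ p) = inj₂ p
  joins-sym (inj₂ p) = inj₁ p

  joins-other : ∀ {e u w y} → Joins G e u w → Joins G e w y → y ≡ u
  joins-other j j′ with same-ends j j′
  ... | inj₁ (w≡u , y≡w) = trans y≡w w≡u
  ... | inj₂ (_ , y≡u)   = y≡u

  infixr 5 _++_
  data Walk : Fin n → Fin n → Set where
    []  : ∀ {u} → Walk u u
    via : ∀ {u w v} (e : Fin m) → Joins G e u w → Walk w v → Walk u v

  len : ∀ {u v} → Walk u v → ℕ
  len []          = 0
  len (via e j q) = suc (len q)

  _++_ : ∀ {u x v} → Walk u x → Walk x v → Walk u v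
  []          ++ r = r
  (via e j q) ++ r = via e j (q ++ r)

  parity : ∀ {u v} → Walk u v → EdgeSet G
  parity []          = ∅
  parity (via e j q) = ⁅ e ⁆ ⊕ parity q

  parity-++ : ∀ {u x v} (p : Walk u x) (q : Walk x v) → parity (p ++ q) ≡ parity p ⊕ parity q
  parity-++ []          q = sym (⊕-identityˡ (parity q))
  parity-++ (via e j p) q = trans (cong (⁅ e ⁆ ⊕_) (parity-++ p q)) (sym (⊕-assoc ⁅ e ⁆ (parity p) (parity q)))

  data _∈E_ (x : Fin m) : ∀ {u v} → Walk u v → Set where
    here  : ∀ {u w v} {j : Joins G x u w} {q : Walk w v} → x ∈E via x j q
    there : ∀ {u w v e} {j : Joins G e u w} {q : Walk w v} → x ∈E q → x ∈E via e j q

  data _∈V_ (x : Fin n) : ∀ {u v} → Walk u v → Set where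
    start : ∀ {v} {p : Walk x v} → x ∈V p
    later : ∀ {u w v e} {j : Joins G e u w} {q : Walk w v} → x ∈V q → x ∈V via e j q

  _∈E?_ : ∀ {u v} x (p : Walk u v) → Dec (x ∈E p)
  x ∈E? []          = no λ ()
  x ∈E? via e j q with x ≟ e | x ∈E? q
  ... | yes refl | _       = yes here
  ... | no _     | yes x∈q = yes (there x∈q)
  ... | no x≢e   | no x∉q  = no λ { here → x≢e refl ; (there x∈q) → x∉q x∈q }

  _∈V?_ : ∀ {u v} x (p : Walk u v) → Dec (x ∈V p)
  _∈V?_ {u} x p with x ≟ u
  ... | yes refl = yes start
  x ∈V? []          | no x≢u = no λ { start → x≢u refl }
  x ∈V? via e j q   | no x≢u with x ∈V? q
  ... | yes x∈q = yes (later x∈q)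
  ... | no x∉q  = no λ { start → x≢u refl ; (later x∈q) → x∉q x∈q }

  AllIn : EdgeSet G → ∀ {u v} → Walk u v → Set
  AllIn S p = ∀ {x} → x ∈E p → x ∈ S

  ∈E-++ˡ : ∀ {x u y v} {p : Walk u y} (q : Walk y v) → x ∈E p → x ∈E (p ++ q)
  ∈E-++ˡ q here        = here
  ∈E-++ˡ q (there x∈p) = there (∈E-++ˡ q x∈p)

  ∈E-++ʳ : ∀ {x u y v} (p : Walk u y) {q : Walk y v} → x ∈E q → x ∈E (p ++ q)
  ∈E-++ʳ []          x∈q = x∈q
  ∈E-++ʳ (via e j p) x∈q = there (∈E-++ʳ p x∈q)

  AllIn-++ : ∀ {S u y v} (p : Walk u y) {q : Walk y v} → AllIn S p → AllIn S q → AllIn S (p ++ q)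
  AllIn-++ []          pS qS x∈    = qS x∈
  AllIn-++ (via e j p) pS qS here  = pS here
  AllIn-++ (via e j p) pS qS (there x∈) = AllIn-++ p (λ x∈p → pS (there x∈p)) qS x∈

  ∈V-++ˡ : ∀ {x u y v} (p : Walk u y) {q : Walk y v} → x ∈V p → x ∈V (p ++ q)
  ∈V-++ˡ []          start       = start
  ∈V-++ˡ (via e j p) start       = start
  ∈V-++ˡ (via e j p) (later x∈p) = later (∈V-++ˡ p x∈p)

  split-at : ∀ {x u v} (p : Walk u v) → x ∈V p → Σ (Walk u x) λ a → Σ (Walk x v) λ s → p ≡ a ++ s
  split-at p           start       = [] , p , refl
  split-at (via e j q) (later x∈q) with split-at q x∈q
  ... | a , s , refl = via e j a , s , refl

  end-visited : ∀ {u v} (p : Walk u v) → v ∈V p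
  end-visited []          = start
  end-visited (via e j q) = later (end-visited q)

  ends-visited : ∀ {x a b u v} {p : Walk u v} → x ∈E p → Joins G x a b → a ∈V p
  ends-visited {p = via _ j q} here j′ with same-ends j j′
  ... | inj₁ (refl , _) = start
  ... | inj₂ (refl , _) = later start
  ends-visited (there x∈q) j′ = later (ends-visited x∈q j′)

  Simple : ∀ {u v} → Walk u v → Set
  Simple []              = ⊤
  Simple (via {u} e j q) = ¬ u ∈V q × Simple q

  Trail : ∀ {u v} → Walk u v → Set
  Trail []          = ⊤
  Trail (via e j q) = ¬ e ∈E q × Trail q

  simple⇒trail : ∀ {u v} (p : Walk u v) → Simple p → Trail p
  simple⇒trail []          _           = tt
  simple⇒trail (via e j q) (u∉q , sq) = (λ e∈q → u∉q (ends-visited e∈q j)) , simple⇒trail q sq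

  simple-closed : ∀ {u} (p : Walk u u) → Simple p → p ≡ []
  simple-closed []          _         = refl
  simple-closed (via e j q) (u∉q , _) = contradiction (end-visited q) u∉q

  simple-++ : ∀ {u x v} (a : Walk u x) (s : Walk x v) → Simple (a ++ s) → Simple a × Simple s
  simple-++ []          s ss              = tt , ss
  simple-++ (via e j a) s (u∉as , sas) with simple-++ a s sas
  ... | sa , ss = ((λ u∈a → u∉as (∈V-++ˡ a u∈a)) , sa) , ss

  ∈parity⇒∈E : ∀ {x u v} (p : Walk u v) → x ∈ parity p → x ∈E p
  ∈parity⇒∈E []          x∈ = contradiction x∈ ∉⊥
  ∈parity⇒∈E (via e j q) x∈ with ∈⊕⁻ ⁅ e ⁆ (parity q) x∈
  ... | inj₁ x∈e rewrite x∈⁅y⁆⇒x≡y e x∈e = here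
  ... | inj₂ x∈q = there (∈parity⇒∈E q x∈q)

  ∈E⇒∈parity : ∀ {x u v} (p : Walk u v) → Trail p → x ∈E p → x ∈ parity p
  ∈E⇒∈parity (via e j q) (e∉q , _) here =
    ∈⊕⁺ˡ (x∈⁅x⁆ e) (λ e∈ → e∉q (∈parity⇒∈E q e∈))
  ∈E⇒∈parity {x} (via e j q) (e∉q , tq) (there x∈q) =
    ∈⊕⁺ʳ (λ x∈e → e∉q (subst (_∈E q) (x∈⁅y⁆⇒x≡y e x∈e) x∈q)) (∈E⇒∈parity q tq x∈q)

  vertexAt : ∀ {u v} (p : Walk u v) → Fin (suc (len p)) → Fin n
  vertexAt {u} p zero          = u
  vertexAt (via e j q) (suc i) = vertexAt q i

  edgeAt : ∀ {u v} (p : Walk u v) → Fin (len p) → Fin m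
  edgeAt (via e j q) zero    = e
  edgeAt (via e j q) (suc i) = edgeAt q i

  edgeAt-joins : ∀ {u v} (p : Walk u v) (i : Fin (len p)) →
                 Joins G (edgeAt p i) (vertexAt p (inject₁ i)) (vertexAt p (suc i))
  edgeAt-joins (via e j q) zero    = j
  edgeAt-joins (via e j q) (suc i) = edgeAt-joins q i

  vertexAt-last : ∀ {u v} (p : Walk u v) → vertexAt p (fromℕ (len p)) ≡ v
  vertexAt-last []          = refl
  vertexAt-last (via e j q) = vertexAt-last q

  vertexAt-visited : ∀ {u v} (p : Walk u v) i → vertexAt p i ∈V p
  vertexAt-visited p           zero    = start
  vertexAt-visited (via e j q) (suc i) = later (vertexAt-visited q i)

  edgeAt-∈E : ∀ {u v} (p : Walk u v) i → edgeAt p i ∈E p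
  edgeAt-∈E (via e j q) zero    = here
  edgeAt-∈E (via e j q) (suc i) = there (edgeAt-∈E q i)

  ∈E⇒edgeAt : ∀ {x u v} {p : Walk u v} → x ∈E p → ∃[ i ] edgeAt p i ≡ x
  ∈E⇒edgeAt here        = zero , refl
  ∈E⇒edgeAt (there x∈q) with ∈E⇒edgeAt x∈q
  ... | i , eq = suc i , eq

  vertexAt-injective : ∀ {u v} (p : Walk u v) → Simple p → Injective _≡_ _≡_ (vertexAt p)
  vertexAt-injective p           _          {zero}  {zero}  _  = refl
  vertexAt-injective (via e j q) (u∉q , _)  {zero}  {suc i} eq = contradiction (subst (_∈V q) (sym eq) (vertexAt-visited q i)) u∉q
  vertexAt-injective (via e j q) (u∉q , _)  {suc i} {zero}  eq = contradiction (subst (_∈V q) eq (vertexAt-visited q i)) u∉q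
  vertexAt-injective (via e j q) (_ , sq)   {suc i} {suc i′} eq = cong suc (vertexAt-injective q sq eq)

  edgeAt-injective : ∀ {u v} (p : Walk u v) → Trail p → Injective _≡_ _≡_ (edgeAt p)
  edgeAt-injective (via e j q) _          {zero}  {zero}  _  = refl
  edgeAt-injective (via e j q) (e∉q , _)  {zero}  {suc i} eq = contradiction (subst (_∈E q) (sym eq) (edgeAt-∈E q i)) e∉q
  edgeAt-injective (via e j q) (e∉q , _)  {suc i} {zero}  eq = contradiction (subst (_∈E q) eq (edgeAt-∈E q i)) e∉q
  edgeAt-injective (via e j q) (_ , tq)   {suc i} {suc i′} eq = cong suc (edgeAt-injective q tq eq)

  close-cycle : ∀ {e u w} (j : Joins G e u w) (a : Walk w u) → Simple a → ¬ e ∈E a →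
                CycleWitness G (parity (via e j a)) (len a)
  close-cycle {e} j a sa e∉a = record
    { vs     = λ i → vertexAt c (inject₁ i)
    ; es     = edgeAt c
    ; vs-inj = vs-injective
    ; es-inj = edgeAt-injective c trail
    ; step   = λ i → edgeAt-joins c (inject₁ i)
    ; close  = subst (Joins G (edgeAt c (fromℕ k)) (vertexAt c (inject₁ (fromℕ k))))
                     (vertexAt-last a) (edgeAt-joins c (fromℕ k))
    ; edges  = λ x → mk⇔ (λ x∈ → ∈E⇒edgeAt (∈parity⇒∈E c x∈))
                         (λ { (i , refl) → ∈E⇒∈parity c trail (edgeAt-∈E c i) })
    }
    where
    c = via e j a
    k = len a
    trail : Trail c
    trail = e∉a , simple⇒trail a sa
    -- the closing vertex u occurs on a only at its end
    vs-injective : Injective _≡_ _≡_ (λ i → vertexAt c (inject₁ i))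
    vs-injective {zero}  {zero}   _  = refl
    vs-injective {zero}  {suc i}  eq = ⊥-elim (fromℕ≢inject₁ {i = i} (vertexAt-injective a sa (trans (vertexAt-last a) eq)))
    vs-injective {suc i} {zero}   eq = ⊥-elim (fromℕ≢inject₁ {i = i} (vertexAt-injective a sa (trans (vertexAt-last a) (sym eq))))
    vs-injective {suc i} {suc i′} eq = cong suc (inject₁-injective (vertexAt-injective a sa eq))

  back-and-forth : ∀ {e u w} (j : Joins G e u w) (a : Walk w u) → Simple a → e ∈E a → parity a ≡ ⁅ e ⁆
  back-and-forth {e} j (via _ j′ a′) (_ , sa′) here with joins-other j j′
  ... | refl = trans (cong (λ q → ⁅ e ⁆ ⊕ parity q) (simple-closed a′ sa′)) (⊕-identityʳ ⁅ e ⁆)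
  back-and-forth j (via _ _ a′) (w∉a′ , _) (there e∈a′) = contradiction (ends-visited e∈a′ (joins-sym j)) w∉a′

  walk-along : ∀ L {t} (V : Fin (suc L) → Fin n) (E : Fin (suc L) → Fin m) →
               (∀ i → Joins G (E (inject₁ i)) (V (inject₁ i)) (V (suc i))) →
               Joins G (E (fromℕ L)) (V (fromℕ L)) t → Walk (V zero) t
  walk-along zero    V E J c = via (E zero) c []
  walk-along (suc L) V E J c = via (E zero) (J zero) (walk-along L (λ i → V (suc i)) (λ i → E (suc i)) (λ i → J (suc i)) c)

  walk-along-edges : ∀ L {t} V E J (c : Joins G (E (fromℕ L)) (V (fromℕ L)) t) {x} →
                     x ∈E walk-along L V E J c → ∃[ i ] E i ≡ x
  walk-along-edges zero    V E J c here        = zero , refl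
  walk-along-edges (suc L) V E J c here        = zero , refl
  walk-along-edges (suc L) V E J c (there x∈) with walk-along-edges L _ _ (λ i → J (suc i)) c x∈
  ... | i , eq = suc i , eq

  walk-along-edges⁺ : ∀ L {t} V E J (c : Joins G (E (fromℕ L)) (V (fromℕ L)) t) i →
                      E i ∈E walk-along L V E J c
  walk-along-edges⁺ zero    V E J c zero    = here
  walk-along-edges⁺ (suc L) V E J c zero    = here
  walk-along-edges⁺ (suc L) V E J c (suc i) = there (walk-along-edges⁺ L _ _ (λ i → J (suc i)) c i)

  walk-along-trail : ∀ L {t} V E J (c : Joins G (E (fromℕ L)) (V (fromℕ L)) t) →
                     Injective _≡_ _≡_ E → Trail (walk-along L V E J c)
  walk-along-trail zero    V E J c E-inj = (λ ()) , tt
  walk-along-trail (suc L) V E J c E-inj =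
    (λ E₀∈ → E₀-unique (proj₂ (walk-along-edges L _ _ J′ c E₀∈))) ,
    walk-along-trail L _ _ J′ c (λ eq → suc-injective (E-inj eq))
    where
    J′ = λ i → J (suc i)
    E₀-unique : ∀ {i} → ¬ E (suc i) ≡ E zero
    E₀-unique eq with E-inj eq
    ... | ()

  module CycleWalk {C : EdgeSet G} {k : ℕ} (cw : CycleWitness G C k) where
    open CycleWitness cw

    cycle-walk : Walk (vs zero) (vs zero)
    cycle-walk = walk-along k vs es step close

    cycle-walk-⊆ : AllIn C cycle-walk
    cycle-walk-⊆ {x} x∈ = Equivalence.from (edges x) (walk-along-edges k vs es step close x∈)

    cycle-walk-parity : parity cycle-walk ≡ C
    cycle-walk-parity = ⊆-antisym (λ x∈ → cycle-walk-⊆ (∈parity⇒∈E cycle-walk x∈)) parity⊇C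
      where
      parity⊇C : C ⊆ parity cycle-walk
      parity⊇C {x} x∈C with Equivalence.to (edges x) x∈C
      ... | i , refl = ∈E⇒∈parity cycle-walk (walk-along-trail k vs es step close es-inj)
                                   (walk-along-edges⁺ k vs es step close i)

  reach⇒walk : ∀ {S u v} → Reach G S u v → Σ (Walk u v) (AllIn S)
  reach⇒walk reach-refl = [] , λ ()
  reach⇒walk (reach-step e e∈S j r) with reach⇒walk r
  ... | p , pS = via e j p , λ { here → e∈S ; (there x∈p) → pS x∈p }

module Forest (G : Graph) (F : EdgeSet G) (acyclic : ∀ D → IsCycle G D → D ⊆ F → ⊥) where
  open Walks G

  -- A simple path in F closed up by an edge of F has empty parity: either
  -- the edge doubles back along the path, or they would form a cycle in F.
  closed-path-parity : ∀ {e u w} (j : Joins G e u w) (a : Walk w u) →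
                       Simple a → AllIn F a → e ∈ F → parity (via e j a) ≡ ∅
  closed-path-parity {e} j a sa aF e∈F with e ∈E? a
  ... | yes e∈a = trans (cong (⁅ e ⁆ ⊕_) (back-and-forth j a sa e∈a)) (⊕-self ⁅ e ⁆)
  ... | no e∉a  = ⊥-elim (acyclic _ (len a , close-cycle j a sa e∉a) cycle⊆F)
    where
    cycle⊆F : parity (via e j a) ⊆ F
    cycle⊆F x∈ with ∈parity⇒∈E (via e j a) x∈
    ... | here      = e∈F
    ... | there x∈a = aF x∈a

  record LoopErasure {u v} (p : Walk u v) : Set where
    field
      path        : Walk u v
      simple      : Simple path
      path⊆F      : AllIn F path
      same-parity : parity path ≡ parity p

  -- Erase loops from the back: after erasing the tail q of  e ∷ q  to a simple
  -- path r, either r avoids the start u, or the loop of  e ∷ r  up to its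
  -- return to u is cut off; that loop has empty parity by closed-path-parity.
  erase : ∀ {u v} (p : Walk u v) → AllIn F p → LoopErasure p
  erase [] _ = record { path = [] ; simple = tt ; path⊆F = λ () ; same-parity = refl }
  erase (via {u} e j q) pF with erase q (λ x∈q → pF (there x∈q))
  ... | record { path = r ; simple = sr ; path⊆F = rF ; same-parity = r≡q } with u ∈V? r
  ...   | no u∉r = record
    { path        = via e j r
    ; simple      = u∉r , sr
    ; path⊆F      = λ { here → pF here ; (there x∈r) → rF x∈r }
    ; same-parity = cong (⁅ e ⁆ ⊕_) r≡q
    }
  ...   | yes u∈r with split-at r u∈r
  ...     | a , s , refl = record
    { path        = s
    ; simple      = proj₂ (simple-++ a s sr)
    ; path⊆F      = λ x∈s → rF (∈E-++ʳ a x∈s)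
    ; same-parity = s≡eq
    }
    where
    open ≡-Reasoning
    loop : parity (via e j a) ≡ ∅
    loop = closed-path-parity j a (proj₁ (simple-++ a s sr)) (λ x∈a → rF (∈E-++ˡ s x∈a)) (pF here)
    s≡eq : parity s ≡ ⁅ e ⁆ ⊕ parity q
    s≡eq = begin
      parity s                         ≡⟨ sym (⊕-identityˡ (parity s)) ⟩
      ∅ ⊕ parity s                     ≡⟨ cong (_⊕ parity s) (sym loop) ⟩
      (⁅ e ⁆ ⊕ parity a) ⊕ parity s    ≡⟨ ⊕-assoc ⁅ e ⁆ (parity a) (parity s) ⟩
      ⁅ e ⁆ ⊕ (parity a ⊕ parity s)    ≡⟨ cong (⁅ e ⁆ ⊕_) (sym (parity-++ a s)) ⟩
      ⁅ e ⁆ ⊕ parity (a ++ s)          ≡⟨ cong (⁅ e ⁆ ⊕_) r≡q ⟩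
      ⁅ e ⁆ ⊕ parity q                 ∎

  closed-walk-parity : ∀ {u} (p : Walk u u) → AllIn F p → parity p ≡ ∅
  closed-walk-parity p pF =
    trans (sym same-parity) (cong parity (simple-closed path simple))
    where open LoopErasure (erase p pF)

module FundamentalCycles (G : Graph) (Ω : BiasedGraph G) (F : EdgeSet G) (tree : IsSpanningTree G F)
                         (C : EdgeSet G) (disjoint : Disjoint G C F) where
  open Graph G
  open Walks G
  open Forest G F (proj₂ tree)
  open BiasedGraph Ω

  private
    erased : ∀ u w → LoopErasure (proj₁ (reach⇒walk (proj₁ tree u w)))
    erased u w = erase _ (proj₂ (reach⇒walk (proj₁ tree u w)))

  tree-path : ∀ u w → Walk u w
  tree-path u w = LoopErasure.path (erased u w)

  tree-path-simple : ∀ u w → Simple (tree-path u w)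
  tree-path-simple u w = LoopErasure.simple (erased u w)

  tree-path-⊆F : ∀ u w → AllIn F (tree-path u w)
  tree-path-⊆F u w = LoopErasure.path⊆F (erased u w)

  fundamental-cycle : Fin m → Fin n → Fin n → EdgeSet G
  fundamental-cycle e u w = ⁅ e ⁆ ⊕ parity (tree-path u w)

  -- it is a cycle in F ∪ {e}, because e ∈ C is not an edge of the tree
  fundamental : ∀ {e u w} → Joins G e u w → e ∈ C → IsFundCycle G e F (fundamental-cycle e u w)
  fundamental {e} {u} {w} j e∈C =
    (len (tree-path u w) , close-cycle (joins-sym j) (tree-path u w) (tree-path-simple u w) e∉path) , ⊆F∪e
    where
    e∉path : ¬ e ∈E tree-path u w
    e∉path e∈ = disjoint e e∈C (tree-path-⊆F u w e∈)
    ⊆F∪e : fundamental-cycle e u w ⊆ F ∪ ⁅ e ⁆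
    ⊆F∪e x∈ with ∈parity⇒∈E (via e (joins-sym j) (tree-path u w)) x∈
    ... | here         = x∈p∪q⁺ (inj₂ (x∈⁅x⁆ e))
    ... | there x∈path = x∈p∪q⁺ (inj₁ (tree-path-⊆F u w x∈path))

  fundamental-sum : ∀ {u v} → Walk u v → EdgeSet G
  fundamental-sum []                  = ∅
  fundamental-sum (via {u} {w} e j q) = fundamental-sum q ⊕ fundamental-cycle e u w

  tree-shadow : ∀ {u v} → Walk u v → Walk u v
  tree-shadow []                  = []
  tree-shadow (via {u} {w} e j q) = tree-path u w ++ tree-shadow q

  tree-shadow-⊆F : ∀ {u v} (p : Walk u v) → AllIn F (tree-shadow p)
  tree-shadow-⊆F []                  = λ ()
  tree-shadow-⊆F (via {u} {w} e j q) = AllIn-++ (tree-path u w) (tree-path-⊆F u w) (tree-shadow-⊆F q)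

  fundamental-sum-split : ∀ {u v} (p : Walk u v) → fundamental-sum p ≡ parity p ⊕ parity (tree-shadow p)
  fundamental-sum-split []                  = sym (⊕-identityʳ ∅)
  fundamental-sum-split (via {u} {w} e j q) = begin
    fundamental-sum q ⊕ (⁅ e ⁆ ⊕ parity P)                   ≡⟨ cong (_⊕ (⁅ e ⁆ ⊕ parity P)) (fundamental-sum-split q) ⟩
    (parity q ⊕ parity (tree-shadow q)) ⊕ (⁅ e ⁆ ⊕ parity P) ≡⟨ ⊕-comm _ _ ⟩
    (⁅ e ⁆ ⊕ parity P) ⊕ (parity q ⊕ parity (tree-shadow q)) ≡⟨ ⊕-interchange ⁅ e ⁆ (parity P) (parity q) _ ⟩
    (⁅ e ⁆ ⊕ parity q) ⊕ (parity P ⊕ parity (tree-shadow q)) ≡⟨ cong (⁅ e ⁆ ⊕ parity q ⊕_) (sym (parity-++ P (tree-shadow q))) ⟩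
    (⁅ e ⁆ ⊕ parity q) ⊕ parity (P ++ tree-shadow q)         ∎
    where
    open ≡-Reasoning
    P = tree-path u w

  -- For a closed walk the tree shadow cancels out.
  closed-fundamental-sum : ∀ {u} (p : Walk u u) → fundamental-sum p ≡ parity p
  closed-fundamental-sum p = begin
    fundamental-sum p                      ≡⟨ fundamental-sum-split p ⟩
    parity p ⊕ parity (tree-shadow p)      ≡⟨ cong (parity p ⊕_) (closed-walk-parity (tree-shadow p) (tree-shadow-⊆F p)) ⟩
    parity p ⊕ ∅                           ≡⟨ ⊕-identityʳ (parity p) ⟩
    parity p                               ∎
    where open ≡-Reasoning

  UnbalancedFundamentalCycle : Set
  UnbalancedFundamentalCycle = ∃[ e ] (e ∈ C × ∃[ D ] (IsFundCycle G e F D × ¬ T (balanced D)))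

  unbalanced-or-spanned : ∀ {u v} (p : Walk u v) → AllIn C p →
                          UnbalancedFundamentalCycle ⊎ InSpan G balanced (fundamental-sum p)
  unbalanced-or-spanned []                  _  = inj₂ span-∅
  unbalanced-or-spanned (via {u} {w} e j q) pC with unbalanced-or-spanned q (λ x∈q → pC (there x∈q))
  ... | inj₁ found   = inj₁ found
  ... | inj₂ spanned with T? (balanced (fundamental-cycle e u w))
  ...   | yes bal   = inj₂ (span-add spanned bal)
  ...   | no unbal  = inj₁ (e , pC here , fundamental-cycle e u w , fundamental j (pC here) , unbal)

-- Otherwise C, the sum of the fundamental cycles along
-- it, would be in the span of the balanced cycles, hence balanced.
lemma3p2 : (G : Graph) (Ω : BiasedGraph G) → IsLinear G Ω →
    (C : EdgeSet G) → IsCycle G C → ¬ T (BiasedGraph.balanced Ω C) →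
    (F : EdgeSet G) → IsSpanningTree G F → Disjoint G C F →
    ∃[ e ] (e ∈ C × ∃[ D ] (IsFundCycle G e F D × ¬ T (BiasedGraph.balanced Ω D)))
lemma3p2 G Ω linear C C-cycle@(k , cw) C-unbalanced F tree disjoint =
  [ id , contradiction-with-linearity ]′ (unbalanced-or-spanned cycle-walk cycle-walk-⊆)
  where
  open Walks.CycleWalk G cw
  open FundamentalCycles G Ω F tree C disjoint
  open BiasedGraph Ω using (balanced)

  sum≡C : fundamental-sum cycle-walk ≡ C
  sum≡C = trans (closed-fundamental-sum cycle-walk) cycle-walk-parity

  contradiction-with-linearity : InSpan G balanced (fundamental-sum cycle-walk) → UnbalancedFundamentalCycle
  contradiction-with-linearity spanned =
    contradiction (linear C C-cycle (subst (InSpan G balanced) sum≡C spanned)) C-unbalanced
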